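{- Let $P$ be a finite poset, and let $A_1,A_2,A_3,A_4$ be pairwise distinct antichains of $P$ such that $\operatorname{conv}(\chi_{A_1},\chi_{A_2},\chi_{A_3},\chi_{A_4})$ is a square face of $\mathcal{C}(P)$. If $A_i$ is covered by $A_j$ in the poset $(\{A_1,A_2,A_3,A_4\},\subseteq)$ for some $i,j\in\{1,2,3,4\}$, then $A_i$ is also covered by $A_j$ in the poset $(\mathcal{A}(P),\subseteq)$.
   Context: For a finite poset $P$, the chain polytope is $\mathcal{C}(P)=\{x\in\mathbb{R}^P: x_p\ge 0 \text{ for all } p,\ x_{p_1}+\dots+x_{p_k}\le 1 \text{ whenever } p_1<\dots<p_k \text{ in } P\}$. A square face is a $2$-dimensional face with exactly four vertices. $\chi_W$ is the characteristic vector of $W\subseteq P$. $\mathcal{A}(P)$ is the set of all antichains of $P$ (including $\emptyset$), ordered by inclusion.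
   Formalization: The chain polytope 𝒞(P) and its square faces are taken over ℚ^P instead of ℝ^P, so points, the face-defining functionals, and the convex and affine coefficients are rational. -}

module Defs where

open import Data.Nat using (ℕ)
open import Data.Fin using (Fin; zero; suc)
open import Data.Fin.Subset using (Subset; _∈_; _⊂_)
open import Data.Vec using (lookup)
open import Data.Bool using (true; false; if_then_else_)
open import Data.List using (List; []; _∷_; map; foldr)
open import Data.List.Relation.Unary.Linked using (Linked)
open import Data.Rational using (ℚ; 0ℚ; 1ℚ; _+_; _*_; _≤_)
open import Data.Product using (Σ; ∃; _×_; _,_)
open import Data.Empty using (⊥)
open import Relation.Nullary using (¬_)
open import Relation.Binary.PropositionalEquality using (_≡_; _≢_)

-- Points of ℚ^P, where the finite poset P has underlying set Fin n.
Point : ℕ → Set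
Point n = Fin n → ℚ

sumℚ : List ℚ → ℚ
sumℚ = foldr _+_ 0ℚ

allFin : (n : ℕ) → List (Fin n)
allFin ℕ.zero = []
allFin (ℕ.suc n) = zero ∷ map suc (allFin n)

Σ[_] : (n : ℕ) → (Fin n → ℚ) → ℚ
Σ[ n ] f = sumℚ (map f (allFin n))

dot : {n : ℕ} → Point n → Point n → ℚ
dot {n} c x = Σ[ n ] (λ p → c p * x p)

IsAntichain : {n : ℕ} → (Fin n → Fin n → Set) → Subset n → Set
IsAntichain _≺_ W = ∀ p q → p ∈ W → q ∈ W → ¬ (p ≺ q)

χ : {n : ℕ} → Subset n → Point n
χ W p = if lookup W p then 1ℚ else 0ℚ

-- Chain polytope 𝒞(P): x ≥ 0 and x_{p₁}+…+x_{p_k} ≤ 1 for every chain p₁ < … < p_k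
InChainPolytope : {n : ℕ} → (Fin n → Fin n → Set) → Point n → Set
InChainPolytope _≺_ x =
  (∀ p → 0ℚ ≤ x p) ×
  (∀ (ps : List _) → Linked _≺_ ps → sumℚ (map x ps) ≤ 1ℚ)

IsFace : {n : ℕ} → (Fin n → Fin n → Set) → (Point n → Set) → Set
IsFace {n} _≺_ F = Σ (Point n) λ c → Σ ℚ λ m →
  (∀ x → InChainPolytope _≺_ x → dot c x ≤ m) ×
  (∀ x → (F x → InChainPolytope _≺_ x × dot c x ≡ m) ×
         (InChainPolytope _≺_ x × dot c x ≡ m → F x))

Σ₄ : (Fin 4 → ℚ) → ℚ
Σ₄ f = f zero + (f (suc zero) + (f (suc (suc zero)) + f (suc (suc (suc zero)))))

comb : {n : ℕ} → (Fin 4 → Point n) → (Fin 4 → ℚ) → Point n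
comb v λ' p = Σ₄ (λ i → λ' i * v i p)

IsConvexCoeffs : (Fin 4 → ℚ) → Set
IsConvexCoeffs λ' = (∀ i → 0ℚ ≤ λ' i) × Σ₄ λ' ≡ 1ℚ

Conv : {n : ℕ} → (Fin 4 → Point n) → Point n → Set
Conv v x = Σ (Fin 4 → ℚ) λ λ' → IsConvexCoeffs λ' × (∀ p → x p ≡ comb v λ' p)

IsVertexOfConv : {n : ℕ} → (Fin 4 → Point n) → Fin 4 → Set
IsVertexOfConv v i = ¬ (Σ (Fin 4 → ℚ) λ λ' →
  λ' i ≡ 0ℚ × IsConvexCoeffs λ' × (∀ p → v i p ≡ comb v λ' p))

IsAffineDep : {n : ℕ} → (Fin 4 → Point n) → (Fin 4 → ℚ) → Set
IsAffineDep v μ = Σ₄ μ ≡ 0ℚ × (∀ p → comb v μ p ≡ 0ℚ)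

-- dim aff(v₀,…,v₃) = 2, i.e. the space of affine dependences has dimension exactly 1
IsDim2 : {n : ℕ} → (Fin 4 → Point n) → Set
IsDim2 v =
  (Σ (Fin 4 → ℚ) λ μ → IsAffineDep v μ × ¬ (∀ i → μ i ≡ 0ℚ)) ×
  (∀ μ ν → IsAffineDep v μ → IsAffineDep v ν →
     Σ ℚ λ a → Σ ℚ λ b → ¬ (a ≡ 0ℚ × b ≡ 0ℚ) × (∀ i → a * μ i + b * ν i ≡ 0ℚ))

-- conv(χ_{A₀},…,χ_{A₃}) is a square face of 𝒞(P):
-- a face, of dimension 2, with exactly the four vertices χ_{A₀},…,χ_{A₃}
IsSquareFace : {n : ℕ} → (Fin n → Fin n → Set) → (Fin 4 → Subset n) → Set
IsSquareFace _≺_ A =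
  IsFace _≺_ (Conv (λ i → χ (A i))) ×
  IsDim2 (λ i → χ (A i)) ×
  (∀ i → IsVertexOfConv (λ i → χ (A i)) i)

CoveredIn4 : {n : ℕ} → (Fin 4 → Subset n) → Fin 4 → Fin 4 → Set
CoveredIn4 A i j = A i ⊂ A j × (∀ k → ¬ (A i ⊂ A k × A k ⊂ A j))

CoveredInAntichains : {n : ℕ} → (Fin n → Fin n → Set) → Subset n → Subset n → Set
CoveredInAntichains _≺_ V W =
  V ⊂ W × (∀ B → IsAntichain _≺_ B → ¬ (V ⊂ B × B ⊂ W))

{-# OPTIONS --safe #-}
-- Suppose A_i ⊂ B ⊂ A_j for an antichain B. Then B′ = A_i ∪ (A_j ∖ B) ⊆ A_j is an antichain as
-- well, and χ_B + χ_B′ = χ_{A_i} + χ_{A_j}. Since χ_B and χ_B′ lie in 𝒞(P), the linear functional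
-- cutting out the face attains its maximum at both, so χ_B lies on the face
-- conv(χ_{A_1},…,χ_{A_4}). A 0/1 vector in the convex hull of 0/1 vectors equals every vector
-- that carries positive weight, so B is some A_k, contradicting the covering among the A_k.
module Submission where

open import Defs
open import Algebra.Bundles using (CommutativeMonoid)
open import Data.Nat using (ℕ)
open import Data.Fin using (Fin; zero; suc)
open import Data.Fin.Properties using (any?)
open import Data.Fin.Subset using (Subset; _⊆_; _⊂_; _∪_; _∩_; ∁; ⁅_⁆)
open import Data.Fin.Subset.Properties using (x∈p∪q⁻; p∩q⊆p)
open import Data.Vec using (lookup; tabulate)
open import Data.Vec.Properties
  using ([]=⇒lookup; lookup⇒[]=; lookup-zipWith; lookup-map; tabulate∘lookup; tabulate-cong)
open import Data.Bool using (Bool; true; false; if_then_else_; _∨_; _∧_; not)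
open import Data.List using ([]; _∷_; map)
open import Data.List.Properties using (map-cong)
open import Data.List.Relation.Unary.All as All using (All; []; _∷_)
open import Data.List.Relation.Unary.AllPairs using (AllPairs; []; _∷_)
open import Data.List.Relation.Unary.Linked.Properties using (Linked⇒AllPairs)
open import Data.Rational using (ℚ; 0ℚ; 1ℚ; _+_; _*_; _≤_; _<_)
open import Data.Rational.Properties
open import Algebra.Properties.CommutativeSemigroup
  (CommutativeMonoid.commutativeSemigroup +-0-commutativeMonoid) using (interchange)
open import Data.Rational.Solver using (module +-*-Solver)
open import Data.Product using (∃; _×_; _,_; proj₁; proj₂)
open import Data.Sum using ([_,_])
open import Function using (_∘_)
open import Relation.Nullary using (¬_; yes; no; contradiction)
open import Relation.Nullary.Decidable using (toWitness; toWitnessFalse)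
open import Relation.Binary.Definitions using (Transitive)
open import Relation.Binary.PropositionalEquality
  using (_≡_; _≢_; refl; sym; trans; cong; cong₂; subst; module ≡-Reasoning)
open import Relation.Binary.Structures using (IsStrictPartialOrder)

toℚ : Bool → ℚ
toℚ b = if b then 1ℚ else 0ℚ

0≤1 : 0ℚ ≤ 1ℚ
0≤1 = toWitness {a? = 0ℚ ≤? 1ℚ} _

1≰0 : ¬ (1ℚ ≤ 0ℚ)
1≰0 = toWitnessFalse {a? = 1ℚ ≤? 0ℚ} _

0≤toℚ : ∀ b → 0ℚ ≤ toℚ b
0≤toℚ true  = 0≤1
0≤toℚ false = ≤-refl

0≤*toℚ : ∀ {x} b → 0ℚ ≤ x → 0ℚ ≤ x * toℚ b
0≤*toℚ {x} true  0≤x = subst (0ℚ ≤_) (sym (*-identityʳ x)) 0≤x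
0≤*toℚ {x} false _   = ≤-reflexive (sym (*-zeroʳ x))

*toℚ≤ : ∀ {x} b → 0ℚ ≤ x → x * toℚ b ≤ x
*toℚ≤ {x} true  _   = ≤-reflexive (*-identityʳ x)
*toℚ≤ {x} false 0≤x = subst (_≤ x) (sym (*-zeroʳ x)) 0≤x

x+y≡m+m⇒x≡m : ∀ {x y m} → x ≤ m → y ≤ m → x + y ≡ m + m → x ≡ m
x+y≡m+m⇒x≡m x≤m y≤m x+y≡m+m =
  ≤-antisym x≤m (≮⇒≥ λ x<m → <-irrefl x+y≡m+m (+-mono-<-≤ x<m y≤m))

sumℚ-map-+ : ∀ {A : Set} (f g : A → ℚ) xs →
             sumℚ (map f xs) + sumℚ (map g xs) ≡ sumℚ (map (λ a → f a + g a) xs)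
sumℚ-map-+ f g []       = refl
sumℚ-map-+ f g (x ∷ xs) =
  trans (interchange (f x) (sumℚ (map f xs)) (g x) (sumℚ (map g xs)))
        (cong (f x + g x +_) (sumℚ-map-+ f g xs))

sumℚ-map-≡0 : ∀ {A : Set} {f : A → ℚ} {xs} → All (λ a → f a ≡ 0ℚ) xs → sumℚ (map f xs) ≡ 0ℚ
sumℚ-map-≡0 []                = refl
sumℚ-map-≡0 (fx≡0 ∷ fxs≡0) = cong₂ _+_ fx≡0 (sumℚ-map-≡0 fxs≡0)

dot-cong : ∀ {n} (c : Point n) {x y : Point n} → (∀ p → x p ≡ y p) → dot c x ≡ dot c y
dot-cong {n} c x≗y = cong sumℚ (map-cong (λ p → cong (c p *_) (x≗y p)) (allFin n))

dot-+ : ∀ {n} (c x y : Point n) → dot c x + dot c y ≡ dot c (λ p → x p + y p)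
dot-+ {n} c x y =
  trans (sumℚ-map-+ _ _ (allFin n))
        (cong sumℚ (map-cong (λ p → sym (*-distribˡ-+ (c p) (x p) (y p))) (allFin n)))

⊆⇒lookup : ∀ {n} {V W : Subset n} → V ⊆ W → ∀ p → lookup V p ≡ true → lookup W p ≡ true
⊆⇒lookup {V = V} V⊆W p p∈V = []=⇒lookup (V⊆W (lookup⇒[]= p V p∈V))

antichain-⊆ : ∀ {n} {_≺_ : Fin n → Fin n → Set} {V W} →
              V ⊆ W → IsAntichain _≺_ W → IsAntichain _≺_ V
antichain-⊆ V⊆W W-antichain p q p∈V q∈V = W-antichain p q (V⊆W p∈V) (V⊆W q∈V)

module _ {n} {_≺_ : Fin n → Fin n → Set} {W : Subset n} (W-antichain : IsAntichain _≺_ W) where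

  χ-antichain-above≡0 : ∀ {p} → lookup W p ≡ true → ∀ {q} → p ≺ q → χ W q ≡ 0ℚ
  χ-antichain-above≡0 {p} p∈W {q} p≺q with lookup W q in q∈W
  ... | true  = contradiction p≺q (W-antichain p q (lookup⇒[]= p W p∈W) (lookup⇒[]= q W q∈W))
  ... | false = refl

  χ-antichain-sum≤1 : ∀ {ps} → AllPairs _≺_ ps → sumℚ (map (χ W) ps) ≤ 1ℚ
  χ-antichain-sum≤1 {[]}     []                  = 0≤1
  χ-antichain-sum≤1 {p ∷ ps} (p≺ps ∷ ps-pairwise) with lookup W p in p∈W
  ... | true  = ≤-reflexive (cong (1ℚ +_)
                  (sumℚ-map-≡0 (All.map (χ-antichain-above≡0 p∈W) p≺ps)))
  ... | false = subst (_≤ 1ℚ) (sym (+-identityˡ _)) (χ-antichain-sum≤1 ps-pairwise)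

χ-antichain∈𝒞 : ∀ {n} {_≺_ : Fin n → Fin n → Set} → Transitive _≺_ →
                ∀ {W} → IsAntichain _≺_ W → InChainPolytope _≺_ (χ W)
χ-antichain∈𝒞 ≺-trans {W} W-antichain =
  0≤toℚ ∘ lookup W , λ ps chain → χ-antichain-sum≤1 W-antichain (Linked⇒AllPairs ≺-trans chain)

toℚ-exchange : ∀ v b w → (v ≡ true → b ≡ true) → (b ≡ true → w ≡ true) →
               toℚ b + toℚ (v ∨ (w ∧ not b)) ≡ toℚ v + toℚ w
toℚ-exchange true  true  true  _   _   = refl
toℚ-exchange true  false _     v⇒b _   = contradiction (v⇒b refl) λ ()
toℚ-exchange _     true  false _   b⇒w = contradiction (b⇒w refl) λ ()
toℚ-exchange false true  true  _   _   = refl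
toℚ-exchange false false true  _   _   = refl
toℚ-exchange false false false _   _   = refl

χ-exchange : ∀ {n} {V B W : Subset n} → V ⊆ B → B ⊆ W →
             ∀ p → χ B p + χ (V ∪ (W ∩ ∁ B)) p ≡ χ V p + χ W p
χ-exchange {V = V} {B} {W} V⊆B B⊆W p
  rewrite lookup-zipWith _∨_ p V (W ∩ ∁ B) | lookup-zipWith _∧_ p W (∁ B) | lookup-map p not B
  = toℚ-exchange (lookup V p) (lookup B p) (lookup W p) (⊆⇒lookup V⊆B p) (⊆⇒lookup B⊆W p)

χ-between-on-face : ∀ {n} {_≺_ : Fin n → Fin n → Set} → Transitive _≺_ →
                    ∀ {F : Point n → Set} → IsFace _≺_ F → ∀ {V B W} →
                    IsAntichain _≺_ B → IsAntichain _≺_ W → V ⊆ B → B ⊆ W →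
                    F (χ V) → F (χ W) → F (χ B)
χ-between-on-face {n} {_≺_} ≺-trans {F} (c , m , valid , F⇔) {V} {B} {W}
                  B-antichain W-antichain V⊆B B⊆W FV FW =
  proj₂ (F⇔ (χ B)) (χB∈𝒞 , c·χB≡m)
  where
  open ≡-Reasoning
  on-face : ∀ {x} → F x → dot c x ≡ m
  on-face Fx = proj₂ (proj₁ (F⇔ _) Fx)
  B′ : Subset n
  B′ = V ∪ (W ∩ ∁ B)
  B′⊆W : B′ ⊆ W
  B′⊆W x∈B′ = [ B⊆W ∘ V⊆B , p∩q⊆p W (∁ B) ] (x∈p∪q⁻ V _ x∈B′)
  χB∈𝒞 : InChainPolytope _≺_ (χ B)
  χB∈𝒞 = χ-antichain∈𝒞 ≺-trans B-antichain
  χB′∈𝒞 : InChainPolytope _≺_ (χ B′)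
  χB′∈𝒞 = χ-antichain∈𝒞 ≺-trans (antichain-⊆ B′⊆W W-antichain)
  c·χB≡m : dot c (χ B) ≡ m
  c·χB≡m = x+y≡m+m⇒x≡m (valid _ χB∈𝒞) (valid _ χB′∈𝒞) (begin
    dot c (χ B) + dot c (χ B′)     ≡⟨ dot-+ c (χ B) (χ B′) ⟩
    dot c (λ p → χ B p + χ B′ p)  ≡⟨ dot-cong c (χ-exchange V⊆B B⊆W) ⟩
    dot c (λ p → χ V p + χ W p)   ≡⟨ dot-+ c (χ V) (χ W) ⟨
    dot c (χ V) + dot c (χ W)      ≡⟨ cong₂ _+_ (on-face FV) (on-face FW) ⟩
    m + m                          ∎)

Σ₄-mono-≤ : ∀ {f g} → (∀ l → f l ≤ g l) → Σ₄ f ≤ Σ₄ g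
Σ₄-mono-≤ f≤g = +-mono-≤ (f≤g _) (+-mono-≤ (f≤g _) (+-mono-≤ (f≤g _) (f≤g _)))

Σ₄-mono-< : ∀ {f g} → (∀ l → f l ≤ g l) → ∀ k → f k < g k → Σ₄ f < Σ₄ g
Σ₄-mono-< f≤g zero                   fk<gk =
  +-mono-<-≤ fk<gk (+-mono-≤ (f≤g _) (+-mono-≤ (f≤g _) (f≤g _)))
Σ₄-mono-< f≤g (suc zero)             fk<gk =
  +-mono-≤-< (f≤g _) (+-mono-<-≤ fk<gk (+-mono-≤ (f≤g _) (f≤g _)))
Σ₄-mono-< f≤g (suc (suc zero))       fk<gk =
  +-mono-≤-< (f≤g _) (+-mono-≤-< (f≤g _) (+-mono-<-≤ fk<gk (f≤g _)))
Σ₄-mono-< f≤g (suc (suc (suc zero))) fk<gk =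
  +-mono-≤-< (f≤g _) (+-mono-≤-< (f≤g _) (+-mono-≤-< (f≤g _) fk<gk))

convex-coeff-positive : ∀ {λ′} → IsConvexCoeffs λ′ → ∃ λ k → 0ℚ < λ′ k
convex-coeff-positive {λ′} (_ , Σλ′≡1) with any? (λ k → 0ℚ <? λ′ k)
... | yes positive    = positive
... | no  no-positive =
  contradiction (subst (_≤ 0ℚ) Σλ′≡1 (Σ₄-mono-≤ λ k → ≮⇒≥ (no-positive ∘ (k ,_)))) 1≰0

toℚ-convex-comb⇒≡ : ∀ {λ′} → IsConvexCoeffs λ′ → (a : Fin 4 → Bool) (b : Bool) →
                    toℚ b ≡ Σ₄ (λ l → λ′ l * toℚ (a l)) → ∀ k → 0ℚ < λ′ k → a k ≡ b
toℚ-convex-comb⇒≡ {λ′} (0≤λ′ , Σλ′≡1) a b b≡Σ k 0<λ′k with a k in ak | b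
... | true  | true  = refl
... | false | false = refl
... | true  | false = contradiction 0<Σ (<-irrefl b≡Σ)
  where
  0<Σ : 0ℚ < Σ₄ (λ l → λ′ l * toℚ (a l))
  0<Σ = Σ₄-mono-< (λ l → 0≤*toℚ (a l) (0≤λ′ l)) k
          (subst (λ t → 0ℚ < λ′ k * toℚ t) (sym ak) (subst (0ℚ <_) (sym (*-identityʳ (λ′ k))) 0<λ′k))
... | false | true  = contradiction Σ<1 (<-irrefl (trans (sym b≡Σ) (sym Σλ′≡1)))
  where
  Σ<1 : Σ₄ (λ l → λ′ l * toℚ (a l)) < Σ₄ λ′
  Σ<1 = Σ₄-mono-< (λ l → *toℚ≤ (a l) (0≤λ′ l)) k
          (subst (λ t → λ′ k * toℚ t < λ′ k) (sym ak) (subst (_< λ′ k) (sym (*-zeroʳ (λ′ k))) 0<λ′k))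

χ∈Conv⇒≡ : ∀ {n} (A : Fin 4 → Subset n) (B : Subset n) →
           Conv (λ k → χ (A k)) (χ B) → ∃ λ k → A k ≡ B
χ∈Conv⇒≡ A B (λ′ , λ′-convex , χB≡) with convex-coeff-positive λ′-convex
... | k , 0<λ′k = k , (begin
  A k                    ≡⟨ tabulate∘lookup (A k) ⟨
  tabulate (lookup (A k)) ≡⟨ tabulate-cong Akp≡Bp ⟩
  tabulate (lookup B)     ≡⟨ tabulate∘lookup B ⟩
  B                       ∎)
  where
  open ≡-Reasoning
  Akp≡Bp : ∀ p → lookup (A k) p ≡ lookup B p
  Akp≡Bp p = toℚ-convex-comb⇒≡ λ′-convex (λ l → lookup (A l) p) (lookup B p) (χB≡ p) k 0<λ′k

Σ₄-χ⁅⁆≡1 : ∀ k → Σ₄ (χ ⁅ k ⁆) ≡ 1ℚ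
Σ₄-χ⁅⁆≡1 zero                   = refl
Σ₄-χ⁅⁆≡1 (suc zero)             = refl
Σ₄-χ⁅⁆≡1 (suc (suc zero))       = refl
Σ₄-χ⁅⁆≡1 (suc (suc (suc zero))) = refl

Σ₄-χ⁅⁆-* : ∀ k (f : Fin 4 → ℚ) → Σ₄ (λ l → χ ⁅ k ⁆ l * f l) ≡ f k
Σ₄-χ⁅⁆-* k f = select k
  where
  open +-*-Solver
  f₀ f₁ f₂ f₃ : ℚ
  f₀ = f zero
  f₁ = f (suc zero)
  f₂ = f (suc (suc zero))
  f₃ = f (suc (suc (suc zero)))
  select : ∀ k → Σ₄ (λ l → χ ⁅ k ⁆ l * f l) ≡ f k
  select zero                   = solve 4 (λ x₀ x₁ x₂ x₃ →
    con 1ℚ :* x₀ :+ (con 0ℚ :* x₁ :+ (con 0ℚ :* x₂ :+ con 0ℚ :* x₃)) := x₀) refl f₀ f₁ f₂ f₃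
  select (suc zero)             = solve 4 (λ x₀ x₁ x₂ x₃ →
    con 0ℚ :* x₀ :+ (con 1ℚ :* x₁ :+ (con 0ℚ :* x₂ :+ con 0ℚ :* x₃)) := x₁) refl f₀ f₁ f₂ f₃
  select (suc (suc zero))       = solve 4 (λ x₀ x₁ x₂ x₃ →
    con 0ℚ :* x₀ :+ (con 0ℚ :* x₁ :+ (con 1ℚ :* x₂ :+ con 0ℚ :* x₃)) := x₂) refl f₀ f₁ f₂ f₃
  select (suc (suc (suc zero))) = solve 4 (λ x₀ x₁ x₂ x₃ →
    con 0ℚ :* x₀ :+ (con 0ℚ :* x₁ :+ (con 0ℚ :* x₂ :+ con 1ℚ :* x₃)) := x₃) refl f₀ f₁ f₂ f₃

vertex∈Conv : ∀ {n} (v : Fin 4 → Point n) k → Conv v (v k)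
vertex∈Conv v k = χ ⁅ k ⁆ , (0≤toℚ ∘ lookup ⁅ k ⁆ , Σ₄-χ⁅⁆≡1 k) , λ p → sym (Σ₄-χ⁅⁆-* k (λ l → v l p))

proposition5p6 : (n : ℕ) (_≺_ : Fin n → Fin n → Set) → IsStrictPartialOrder _≡_ _≺_ →
    (A : Fin 4 → Subset n) → (∀ i → IsAntichain _≺_ (A i)) →
    (∀ i j → i ≢ j → A i ≢ A j) →
    IsSquareFace _≺_ A →
    ∀ i j → CoveredIn4 A i j → CoveredInAntichains _≺_ (A i) (A j)
proposition5p6 n _≺_ ≺-spo A A-antichain _ (face , _) i j (Ai⊂Aj , nothing-between) =
  Ai⊂Aj , nothing-between-in-𝒜
  where
  nothing-between-in-𝒜 : ∀ B → IsAntichain _≺_ B → ¬ (A i ⊂ B × B ⊂ A j)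
  nothing-between-in-𝒜 B B-antichain Ai⊂B⊂Aj@((Ai⊆B , _) , (B⊆Aj , _)) =
    let k , Ak≡B = χ∈Conv⇒≡ A B χB∈face
    in  nothing-between k (subst (λ X → A i ⊂ X × X ⊂ A j) (sym Ak≡B) Ai⊂B⊂Aj)
    where
    χB∈face : Conv (χ ∘ A) (χ B)
    χB∈face = χ-between-on-face (IsStrictPartialOrder.trans ≺-spo) face
      B-antichain (A-antichain j) Ai⊆B B⊆Aj (vertex∈Conv (χ ∘ A) i) (vertex∈Conv (χ ∘ A) j)
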